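{- There is an absolute constant $c>0$ such that for all integers $n\ge 2$, $q\ge 1$, $m\ge 1$, every antichain $\Pi\subset\{0,1\}^m$ of cardinality $n!$ and every bijection between $\Pi$ and the permutations of $\{0,\ldots,n-1\}$, $$L(P_{q,\Pi})\ge qn\log_2 n - c\,qn.$$
   Context: $L(F)$ denotes the minimal number of gates in a circuit over the basis $\{\vee,\wedge\}$ (binary disjunction and conjunction gates, inputs being the variables) computing the (possibly partially defined) boolean operator $F$; a circuit computes a partially defined operator if its outputs agree with $F$ on every input where $F$ is defined. Let $X=(x_0,\ldots,x_{n-1})$ with $x_i=(x_{i,0},\ldots,x_{i,q-1})^T$ be a $q\times n$ matrix of boolean variables and $Y$ a vector of $m$ boolean variables. Given the antichain $\Pi$ with a bijection assigning to each element of $\Pi$ a permutation $\pi$ of $\{0,\ldots,n-1\}$, the monotone permutation operator $P_{q,\Pi}(X,Y)$ is the partially defined operator defined only for $Y\in\Pi$, with $P_{q,\Pi}(X,Y)=(x_{\pi(0)},\ldots,x_{\pi(n-1)})$ where $\pi$ is the permutation assigned to $Y$. -}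

module Defs where

open import Data.Nat using (ℕ; zero; suc; _+_; _*_; _^_; _≤_; _<_)
open import Data.Bool using (Bool; true; false; _∧_; _∨_) renaming (_≤_ to _≤ᵇ_)
open import Data.Fin using (Fin)
open import Data.Sum using (_⊎_; inj₁; inj₂)
open import Data.Product using (_×_; _,_)
open import Data.Vec using (Vec; []; _∷_; lookup)
open import Data.Fin.Permutation using (Permutation′; _⟨$⟩ʳ_; _≈_)
open import Relation.Binary.PropositionalEquality using (_≡_)

data Op : Set where
  or and : Op

applyOp : Op → Bool → Bool → Bool
applyOp or  a b = a ∨ b
applyOp and a b = a ∧ b

Node : Set → ℕ → Set
Node I k = Fin k ⊎ I

-- Straight-line {∨,∧}-circuit over inputs indexed by I with s gates
-- (each gate binary, arguments are inputs or earlier gates; no constants).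
data Gates (I : Set) : ℕ → Set where
  []  : Gates I 0
  _▷_ : ∀ {k} → Gates I k → Op × Node I k × Node I k → Gates I (suc k)

nodeVal : ∀ {I k} → (I → Bool) → Vec Bool k → Node I k → Bool
nodeVal x v (inj₁ g) = lookup v g
nodeVal x v (inj₂ i) = x i

-- values of all gates (the most recently added gate at the head)
gateVals : ∀ {I s} → Gates I s → (I → Bool) → Vec Bool s
gateVals []              x = []
gateVals (G ▷ (o , a , b)) x =
  let v = gateVals G x in applyOp o (nodeVal x v a) (nodeVal x v b) ∷ v

record Circuit (I O : Set) (s : ℕ) : Set where
  field
    gates  : Gates I s
    output : O → Node I s

evalC : ∀ {I O s} → Circuit I O s → (I → Bool) → O → Bool
evalC C x o = nodeVal x (gateVals (Circuit.gates C) x) (Circuit.output C o)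

-- Inputs of P_{q,Π}: x_{i,j} (column i ∈ Fin n, row j ∈ Fin q) and y_k (k ∈ Fin m).
PInput : ℕ → ℕ → ℕ → Set
PInput n q m = (Fin n × Fin q) ⊎ Fin m

-- Outputs: entry j of the i-th output column.
POutput : ℕ → ℕ → Set
POutput n q = Fin n × Fin q

assign : ∀ {n q m} → (Fin n → Fin q → Bool) → Vec Bool m → PInput n q m → Bool
assign X Y (inj₁ (i , j)) = X i j
assign X Y (inj₂ k)       = lookup Y k

_≤ᵛ_ : ∀ {m} → Vec Bool m → Vec Bool m → Set
_≤ᵛ_ {m} u v = (k : Fin m) → lookup u k ≤ᵇ lookup v k

-- σ : permutations → {0,1}^m is a bijection onto its image Π
-- (i.e. injective up to extensional equality of permutations).
InjectivePerm : ∀ {n m} → (Permutation′ n → Vec Bool m) → Set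
InjectivePerm {n} σ = ∀ π ρ → σ π ≡ σ ρ → π ≈ ρ

AntichainImage : ∀ {n m} → (Permutation′ n → Vec Bool m) → Set
AntichainImage {n} σ = ∀ π ρ → σ π ≤ᵛ σ ρ → σ π ≡ σ ρ

-- C computes the partial operator P_{q,Π}: for Y = σ(π) ∈ Π, output
-- column i equals x_{π(i)}.
ComputesP : ∀ {n q m s} → (Permutation′ n → Vec Bool m) →
            Circuit (PInput n q m) (POutput n q) s → Set
ComputesP {n} {q} {m} σ C =
  ∀ (π : Permutation′ n) (X : Fin n → Fin q → Bool) (i : Fin n) (j : Fin q) →
    evalC C (assign X (σ π)) (i , j) ≡ X (π ⟨$⟩ʳ i) j

module Submission where

-- Fix the selector Y = σ π.  A node v carries the variable x_{a,j} if v is 1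
-- when x_{a,j} is the only 1 among the x's and 0 when x_{a,j} is the only 0.
-- By monotonicity a gate carries at most one variable, while output (i , j)
-- carries x_{π i, j}.  A carrying gate has a carrying argument, so output
-- (i , j) reaches x_{π i, j} through at most d gates, d being the number of
-- gates carrying x_{π i, j}.  Take for π the n cyclic rotations ρ_k: for
-- fixed (i , j) the variables x_{ρ_k i, j} are distinct, and at most 2^u
-- inputs lie within u gates of a node, so a Kraft-type inequality gives
-- Σ_k d_k ≥ tn − n where 2^t ≤ n < 2^(t+1); for fixed k all the d's together
-- count each gate at most once, so they sum to at most s.  Double counting
-- yields qtn ≤ s + qn, hence n^{qn} ≤ 2^{s + 2qn}.

open import Defs
open import Data.Bool using (Bool; true; false; _∧_; not; T)
open import Data.Bool.Properties using (T-∧; T-∨)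
open import Data.Empty using (⊥-elim)
open import Data.Fin using (Fin; zero; suc; toℕ; fromℕ<)
import Data.Fin.Properties as Finₚ
open import Data.Fin.Permutation using (Permutation′; permutation; _⟨$⟩ʳ_)
open import Data.List using (List; []; _∷_; _++_; length)
open import Data.List.Properties using (length-++)
open import Data.List.Membership.Propositional using (_∈_)
open import Data.List.Membership.Propositional.Properties using (∈-++⁺ˡ; ∈-++⁺ʳ; ∈-++⁻)
open import Data.List.Relation.Unary.Any using (here; there)
open import Data.Nat using (ℕ; zero; suc; _+_; _*_; _∸_; _^_; _≤_; _<_; _⊓_; _≤ᵇ_; _<?_; _%_; z≤n; s≤s; NonZero; >-nonZero)
open import Data.Nat.DivMod using (m%n<n; %-distribˡ-+; m%n%n≡m%n; [m+n]%n≡m%n; m<n⇒m%n≡m)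
open import Data.Nat.Properties
open import Data.Nat.Solver using (module +-*-Solver)
open import Data.Product using (Σ; ∃; _×_; _,_; proj₁; proj₂)
import Data.Product as Product
import Data.Product.Properties as Productₚ
open import Data.Sum using (_⊎_; inj₁; inj₂)
import Data.Sum as Sum
import Data.Sum.Properties as Sumₚ
open import Data.Vec using (Vec; lookup)
open import Function.Base using (_∘_)
open import Function.Bundles using (module Equivalence)
open Equivalence using (to; from)
open import Function.Definitions using (Injective)
open import Relation.Binary.Definitions using (DecidableEquality)
open import Relation.Binary.PropositionalEquality
  using (_≡_; _≢_; refl; sym; trans; cong; cong₂; subst; module ≡-Reasoning)
open import Relation.Nullary using (yes; no; isYes; ¬_)
open import Relation.Nullary.Decidable using (T?; toWitness; fromWitness; fromWitnessFalse)
open import Algebra.Properties.CommutativeMonoid.Sum +-0-commutativeMonoid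
  using (sum; sum-syntax; sum-cong-≗; ∑-distrib-+; ∑-comm; sum-permute)

∑-mono-≤ : ∀ {n} {f g : Fin n → ℕ} → (∀ i → f i ≤ g i) → sum f ≤ sum g
∑-mono-≤ {zero}  f≤g = z≤n
∑-mono-≤ {suc n} f≤g = +-mono-≤ (f≤g zero) (∑-mono-≤ (λ i → f≤g (suc i)))

∑-const : ∀ n c → ∑[ i < n ] c ≡ n * c
∑-const zero    c = refl
∑-const (suc n) c = cong (c +_) (∑-const n c)

∑-zero : ∀ {n} (f : Fin n → ℕ) → (∀ i → f i ≡ 0) → sum f ≡ 0
∑-zero {zero}  f zeros = refl
∑-zero {suc n} f zeros = cong₂ _+_ (zeros zero) (∑-zero (λ i → f (suc i)) (λ i → zeros (suc i)))

∑-positive : ∀ {n} (f : Fin n → ℕ) → 0 < sum f → ∃ λ i → 0 < f i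
∑-positive {suc n} f pos with f zero in f₀
... | suc _ = zero , subst (0 <_) (sym f₀) (s≤s z≤n)
... | zero  = let i , fi>0 = ∑-positive (λ i → f (suc i)) pos in suc i , fi>0

∑-atMostOne : ∀ {n} (f : Fin n → ℕ) → (∀ i → f i ≤ 1) →
              (∀ {i i′} → 0 < f i → 0 < f i′ → i ≡ i′) → sum f ≤ 1
∑-atMostOne {zero}  f f≤1 unique = z≤n
∑-atMostOne {suc n} f f≤1 unique with f zero in f₀
... | zero  = ∑-atMostOne (λ i → f (suc i)) (λ i → f≤1 (suc i))
                (λ p p′ → Finₚ.suc-injective (unique p p′))
... | suc x = begin
  suc x + ∑[ i < n ] f (suc i)  ≡⟨ cong (suc x +_) (∑-zero (λ i → f (suc i)) only-zero) ⟩
  suc x + 0                     ≡⟨ +-identityʳ (suc x) ⟩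
  suc x                         ≡⟨ f₀ ⟨
  f zero                        ≤⟨ f≤1 zero ⟩
  1                             ∎
  where
  open ≤-Reasoning
  only-zero : ∀ i → f (suc i) ≡ 0
  only-zero i with f (suc i) in fᵢ
  ... | zero  = refl
  ... | suc _ with unique (subst (0 <_) (sym f₀) (s≤s z≤n)) (subst (0 <_) (sym fᵢ) (s≤s z≤n))
  ...   | ()

χ : Bool → ℕ
χ true  = 1
χ false = 0

χ≤1 : ∀ b → χ b ≤ 1
χ≤1 true  = ≤-refl
χ≤1 false = z≤n

χ-T : ∀ {b} → T b → χ b ≡ 1
χ-T {true} _ = refl

χ>0⇒T : ∀ {b} → 0 < χ b → T b
χ>0⇒T {true} _ = _

count : ∀ {n} → (Fin n → Bool) → ℕ
count {n} b = ∑[ k < n ] χ (b k)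

count-none : ∀ {n} (b : Fin n → Bool) → (∀ k → ¬ T (b k)) → count b ≡ 0
count-none b none = ∑-zero (λ k → χ (b k)) χ-none
  where
  χ-none : ∀ k → χ (b k) ≡ 0
  χ-none k with b k | none k
  ... | true  | b̸ = ⊥-elim (b̸ _)
  ... | false | _ = refl

count-atMostOne : ∀ {n} (b : Fin n → Bool) →
                  (∀ {k k′} → T (b k) → T (b k′) → k ≡ k′) → count b ≤ 1
count-atMostOne b unique =
  ∑-atMostOne (λ k → χ (b k)) (λ k → χ≤1 (b k)) (λ p p′ → unique (χ>0⇒T p) (χ>0⇒T p′))

count₂-atMostOne : ∀ {a b} (P : Fin a → Fin b → Bool) →
                   (∀ {i j i′ j′} → T (P i j) → T (P i′ j′) → i ≡ i′ × j ≡ j′) →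
                   ∑[ i < a ] count (P i) ≤ 1
count₂-atMostOne P unique =
  ∑-atMostOne (λ i → count (P i))
    (λ i → count-atMostOne (P i) (λ p p′ → proj₂ (unique p p′)))
    (λ {i} {i′} p p′ →
      let j , pj = ∑-positive (λ j → χ (P i j)) p
          j′ , pj′ = ∑-positive (λ j → χ (P i′ j)) p′
      in proj₁ (unique (χ>0⇒T pj) (χ>0⇒T pj′)))

χ-split : ∀ x y → χ y ≤ χ x + χ (not x ∧ y)
χ-split true  y = χ≤1 y
χ-split false y = ≤-refl

count-injection : ∀ {n} {A : Set} → DecidableEquality A →
                  (τ : Fin n → A) → Injective _≡_ _≡_ τ →
                  (b : Fin n → Bool) (R : List A) → (∀ k → T (b k) → τ k ∈ R) →
                  count b ≤ length R
count-injection _≟_ τ τ-inj b [] inR =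
  ≤-reflexive (count-none b none)
  where
  none : ∀ k → ¬ T (b k)
  none k bk with inR k bk
  ... | ()
count-injection {n} _≟_ τ τ-inj b (r ∷ R) inR = begin
  count b                                       ≤⟨ ∑-mono-≤ (λ k → χ-split (hit k) (b k)) ⟩
  ∑[ k < n ] (χ (hit k) + χ (rest k))           ≡⟨ ∑-distrib-+ (λ k → χ (hit k)) (λ k → χ (rest k)) ⟩
  count hit + count rest                        ≤⟨ +-mono-≤ hit-once (count-injection _≟_ τ τ-inj rest R rest∈R) ⟩
  1 + length R                                  ∎
  where
  open ≤-Reasoning
  hit : Fin n → Bool
  hit k = isYes (τ k ≟ r)
  rest : Fin n → Bool
  rest k = not (hit k) ∧ b k
  hit-once : count hit ≤ 1
  hit-once = count-atMostOne hit (λ {k} {k′} h h′ →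
    τ-inj (trans (toWitness {a? = τ k ≟ r} h) (sym (toWitness {a? = τ k′ ≟ r} h′))))
  rest∈R : ∀ k → T (rest k) → τ k ∈ R
  rest∈R k restk with τ k ≟ r
  ... | yes _  = ⊥-elim restk
  ... | no τk≢r with inR k restk
  ...   | here τk≡r = ⊥-elim (τk≢r τk≡r)
  ...   | there τk∈R = τk∈R

-- min(g, u+1) = min(g, u) + [u < g], written without subtraction.
⊓-suc : ∀ g u → g ⊓ suc u + χ (g ≤ᵇ u) ≡ g ⊓ u + 1
⊓-suc zero          u       = refl
⊓-suc (suc zero)    zero    = refl
⊓-suc (suc (suc g)) zero    = refl
⊓-suc (suc zero)    (suc u) = refl
⊓-suc (suc (suc g)) (suc u) = cong suc (⊓-suc (suc g) u)

kraft : ∀ {r} (d : Fin r → ℕ) → (∀ u → count (λ k → d k ≤ᵇ u) ≤ 2 ^ u) →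
        ∀ u → u * r + 1 ≤ ∑[ k < r ] (d k ⊓ u) + 2 ^ u
kraft d few zero = m≤n+m 1 _
kraft {r} d few (suc u) = begin
  suc u * r + 1      ≡⟨ solve 2 (λ u r → (con 1 :+ u) :* r :+ con 1 := r :+ (u :* r :+ con 1)) refl u r ⟩
  r + (u * r + 1)    ≤⟨ +-monoʳ-≤ r (kraft d few u) ⟩
  r + (A₀ + 2 ^ u)   ≡⟨ solve 3 (λ r a p → r :+ (a :+ p) := (a :+ r) :+ p) refl r A₀ (2 ^ u) ⟩
  A₀ + r + 2 ^ u     ≡⟨ cong (_+ 2 ^ u) truncation-step ⟨
  A + B + 2 ^ u      ≤⟨ +-monoˡ-≤ (2 ^ u) (+-monoʳ-≤ A (few u)) ⟩
  A + 2 ^ u + 2 ^ u  ≡⟨ solve 2 (λ a p → a :+ p :+ p := a :+ (p :+ (p :+ con 0))) refl A (2 ^ u) ⟩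
  A + 2 ^ suc u      ∎
  where
  open ≤-Reasoning
  open +-*-Solver
  A A₀ B : ℕ
  A  = ∑[ k < r ] (d k ⊓ suc u)
  A₀ = ∑[ k < r ] (d k ⊓ u)
  B  = count (λ k → d k ≤ᵇ u)
  truncation-step : A + B ≡ A₀ + r
  truncation-step = begin-equality
    A + B                              ≡⟨ ∑-distrib-+ (λ k → d k ⊓ suc u) (λ k → χ (d k ≤ᵇ u)) ⟨
    ∑[ k < r ] (d k ⊓ suc u + χ (d k ≤ᵇ u)) ≡⟨ sum-cong-≗ {r} (λ k → ⊓-suc (d k) u) ⟩
    ∑[ k < r ] (d k ⊓ u + 1)           ≡⟨ ∑-distrib-+ (λ k → d k ⊓ u) (λ _ → 1) ⟩
    A₀ + ∑[ k < r ] 1                  ≡⟨ cong (A₀ +_) (trans (∑-const r 1) (*-identityʳ r)) ⟩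
    A₀ + r                             ∎

depth-sum-bound : ∀ {r} (d : Fin r → ℕ) → (∀ u → count (λ k → d k ≤ᵇ u) ≤ 2 ^ u) →
                  ∀ t → 2 ^ t ≤ r → t * r ≤ ∑[ k < r ] d k + r
depth-sum-bound d few t 2^t≤r =
  ≤-trans (m≤m+n (t * _) 1)
    (≤-trans (kraft d few t) (+-mono-≤ (∑-mono-≤ (λ k → m⊓n≤m (d k) t)) 2^t≤r))

∑₂-distrib-+ : ∀ {a b} (f g : Fin a → Fin b → ℕ) →
               ∑[ i < a ] ∑[ j < b ] (f i j + g i j) ≡ ∑[ i < a ] ∑[ j < b ] f i j + ∑[ i < a ] ∑[ j < b ] g i j
∑₂-distrib-+ {a} {b} f g =
  trans (sum-cong-≗ {a} (λ i → ∑-distrib-+ (f i) (g i)))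
        (∑-distrib-+ (λ i → ∑[ j < b ] f i j) (λ i → ∑[ j < b ] g i j))

double-counting : ∀ {a b r} (f : Fin a → Fin b → Fin r → ℕ) (s u c : ℕ) →
                  (∀ k → ∑[ i < a ] ∑[ j < b ] f i j k ≤ s) →
                  (∀ i j → u ≤ ∑[ k < r ] f i j k + c) →
                  a * (b * u) ≤ r * s + a * (b * c)
double-counting {a} {b} {r} f s u c column row = begin
  a * (b * u)                                                  ≡⟨ ∑∑-const u ⟨
  ∑[ i < a ] ∑[ j < b ] u                                      ≤⟨ ∑-mono-≤ (λ i → ∑-mono-≤ (row i)) ⟩
  ∑[ i < a ] ∑[ j < b ] (∑[ k < r ] f i j k + c)               ≡⟨ ∑₂-distrib-+ (λ i j → ∑[ k < r ] f i j k) (λ _ _ → c) ⟩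
  ∑[ i < a ] ∑[ j < b ] ∑[ k < r ] f i j k + ∑[ i < a ] ∑[ j < b ] c
                                                               ≡⟨ cong₂ _+_ exchange (∑∑-const c) ⟩
  ∑[ k < r ] ∑[ i < a ] ∑[ j < b ] f i j k + a * (b * c)        ≤⟨ +-monoˡ-≤ _ (∑-mono-≤ column) ⟩
  ∑[ k < r ] s + a * (b * c)                                   ≡⟨ cong (_+ a * (b * c)) (∑-const r s) ⟩
  r * s + a * (b * c)                                          ∎
  where
  open ≤-Reasoning
  ∑∑-const : ∀ x → ∑[ i < a ] ∑[ j < b ] x ≡ a * (b * x)
  ∑∑-const x = trans (sum-cong-≗ {a} (λ i → ∑-const b x)) (∑-const a (b * x))
  exchange : ∑[ i < a ] ∑[ j < b ] ∑[ k < r ] f i j k ≡ ∑[ k < r ] ∑[ i < a ] ∑[ j < b ] f i j k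
  exchange = trans (sum-cong-≗ {a} (λ i → ∑-comm (f i)))
                   (∑-comm (λ i k → ∑[ j < b ] f i j k))

dyadic-interval : ∀ n → .{{NonZero n}} → ∃ λ t → 2 ^ t ≤ n × n < 2 ^ suc t
dyadic-interval (suc zero) = 0 , ≤-refl , s≤s (s≤s z≤n)
dyadic-interval (suc (suc n)) with dyadic-interval (suc n)
... | t , lower , upper with suc (suc n) <? 2 ^ suc t
...   | yes below    = t , ≤-trans lower (n≤1+n _) , below
...   | no  notBelow = suc t , ≤-reflexive (sym n≡2^[1+t]) , n<2^[2+t]
  where
  n≡2^[1+t] : suc (suc n) ≡ 2 ^ suc t
  n≡2^[1+t] = ≤-antisym upper (≮⇒≥ notBelow)
  n<2^[2+t] : suc (suc n) < 2 ^ suc (suc t)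
  n<2^[2+t] = subst (_< 2 ^ suc (suc t)) (sym n≡2^[1+t])
                (^-monoʳ-< 2 (s≤s (s≤s z≤n)) (n<1+n (suc t)))

power-bound : ∀ n q s t → n < 2 ^ suc t → q * (t * n) ≤ s + q * n →
              n ^ (q * n) ≤ 2 ^ (s + 2 * (q * n))
power-bound n q s t n<2^[1+t] qtn≤s+qn = begin
  n ^ (q * n)            ≤⟨ ^-monoˡ-≤ (q * n) (<⇒≤ n<2^[1+t]) ⟩
  (2 ^ suc t) ^ (q * n)  ≡⟨ ^-*-assoc 2 (suc t) (q * n) ⟩
  2 ^ (suc t * (q * n))  ≤⟨ ^-monoʳ-≤ 2 exponent-bound ⟩
  2 ^ (s + 2 * (q * n))  ∎
  where
  open ≤-Reasoning
  open +-*-Solver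
  exponent-bound : suc t * (q * n) ≤ s + 2 * (q * n)
  exponent-bound = begin
    suc t * (q * n)      ≡⟨ solve 3 (λ t q n → (con 1 :+ t) :* (q :* n) := q :* n :+ q :* (t :* n)) refl t q n ⟩
    q * n + q * (t * n)  ≤⟨ +-monoʳ-≤ (q * n) qtn≤s+qn ⟩
    q * n + (s + q * n)  ≡⟨ solve 2 (λ s x → x :+ (s :+ x) := s :+ con 2 :* x) refl s (q * n) ⟩
    s + 2 * (q * n)      ∎

-- Cyclic shifts of Fin n: rotation k sends i to i + k (mod n).  For a
-- fixed i, distinct k send i to distinct places, so the n rotations form
-- a Latin square.
module Rotation (n : ℕ) .{{_ : NonZero n}} where

  shift : ℕ → Fin n → Fin n
  shift c i = fromℕ< (m%n<n (toℕ i + c) n)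

  toℕ-shift : ∀ c i → toℕ (shift c i) ≡ (toℕ i + c) % n
  toℕ-shift c i = Finₚ.toℕ-fromℕ< (m%n<n (toℕ i + c) n)

  %-absorbˡ : ∀ x y → (x % n + y) % n ≡ (x + y) % n
  %-absorbˡ x y = begin
    (x % n + y) % n            ≡⟨ %-distribˡ-+ (x % n) y n ⟩
    (x % n % n + y % n) % n    ≡⟨ cong (λ z → (z + y % n) % n) (m%n%n≡m%n x n) ⟩
    (x % n + y % n) % n        ≡⟨ %-distribˡ-+ x y n ⟨
    (x + y) % n                ∎
    where open ≡-Reasoning

  shift-shift : ∀ c d i → shift c (shift d i) ≡ shift (d + c) i
  shift-shift c d i = Finₚ.toℕ-injective (begin
    toℕ (shift c (shift d i))  ≡⟨ toℕ-shift c (shift d i) ⟩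
    (toℕ (shift d i) + c) % n  ≡⟨ cong (λ z → (z + c) % n) (toℕ-shift d i) ⟩
    ((toℕ i + d) % n + c) % n  ≡⟨ %-absorbˡ (toℕ i + d) c ⟩
    (toℕ i + d + c) % n        ≡⟨ cong (_% n) (+-assoc (toℕ i) d c) ⟩
    (toℕ i + (d + c)) % n      ≡⟨ toℕ-shift (d + c) i ⟨
    toℕ (shift (d + c) i)      ∎)
    where open ≡-Reasoning

  shift-by-n : ∀ i → shift n i ≡ i
  shift-by-n i = Finₚ.toℕ-injective
    (trans (toℕ-shift n i) (trans ([m+n]%n≡m%n (toℕ i) n) (m<n⇒m%n≡m (Finₚ.toℕ<n i))))

  unshift-shift : ∀ c → c ≤ n → ∀ i → shift (n ∸ c) (shift c i) ≡ i
  unshift-shift c c≤n i =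
    trans (shift-shift (n ∸ c) c i) (trans (cong (λ e → shift e i) (m+[n∸m]≡n c≤n)) (shift-by-n i))

  shift-unshift : ∀ c → c ≤ n → ∀ i → shift c (shift (n ∸ c) i) ≡ i
  shift-unshift c c≤n i =
    trans (shift-shift c (n ∸ c) i) (trans (cong (λ e → shift e i) (m∸n+n≡m c≤n)) (shift-by-n i))

  toℕ≤n : (k : Fin n) → toℕ k ≤ n
  toℕ≤n k = <⇒≤ (Finₚ.toℕ<n k)

  rotation : Fin n → Permutation′ n
  rotation k = permutation (shift (toℕ k)) (shift (n ∸ toℕ k))
                 (shift-unshift (toℕ k) (toℕ≤n k)) (unshift-shift (toℕ k) (toℕ≤n k))

  -- Shifting i by k is shifting k by i, so injectivity in k follows from
  -- invertibility of shift (toℕ i).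
  rotation-injective : ∀ i {k k′} → rotation k ⟨$⟩ʳ i ≡ rotation k′ ⟨$⟩ʳ i → k ≡ k′
  rotation-injective i {k} {k′} same = begin
    k                                           ≡⟨ unshift-shift (toℕ i) (toℕ≤n i) k ⟨
    shift (n ∸ toℕ i) (shift (toℕ i) k)         ≡⟨ cong (shift (n ∸ toℕ i)) (Finₚ.toℕ-injective same-shift-of-i) ⟩
    shift (n ∸ toℕ i) (shift (toℕ i) k′)        ≡⟨ unshift-shift (toℕ i) (toℕ≤n i) k′ ⟩
    k′                                          ∎
    where
    open ≡-Reasoning
    commute : ∀ k → toℕ (shift (toℕ i) k) ≡ toℕ (shift (toℕ k) i)
    commute k = trans (toℕ-shift (toℕ i) k)
                  (trans (cong (_% n) (+-comm (toℕ k) (toℕ i))) (sym (toℕ-shift (toℕ k) i)))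
    same-shift-of-i : toℕ (shift (toℕ i) k) ≡ toℕ (shift (toℕ i) k′)
    same-shift-of-i = trans (commute k) (trans (cong toℕ same) (sym (commute k′)))

falls : Bool → Bool → Bool
falls u w = u ∧ not w

falls-intro : ∀ {u w} → T u → ¬ T w → T (falls u w)
falls-intro {true} {true}  _ w̸ = w̸ _
falls-intro {true} {false} _ _ = _

falls-elim : ∀ {u w} → T (falls u w) → T u × ¬ T w
falls-elim {true} {false} _ = _ , λ ()

T-not : ∀ {b} → T b → ¬ T (not b)
T-not {true} _ ()

no-self-fall : ∀ u → ¬ T (falls u u)
no-self-fall true ()

no-fall⇒rise : ∀ u w → ¬ T (falls u w) → T u → T w
no-fall⇒rise true true  _      _ = _
no-fall⇒rise true false no-fall _ = ⊥-elim (no-fall _)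

applyOp-mono : ∀ o {a b a′ b′} → (T a → T a′) → (T b → T b′) →
               T (applyOp o a b) → T (applyOp o a′ b′)
applyOp-mono or  {a} {b} {a′} {b′} a→a′ b→b′ =
  from (T-∨ {a′} {b′}) ∘ Sum.map a→a′ b→b′ ∘ to (T-∨ {a} {b})
applyOp-mono and {a} {b} {a′} {b′} a→a′ b→b′ =
  from (T-∧ {a′} {b′}) ∘ Product.map a→a′ b→b′ ∘ to (T-∧ {a} {b})

applyOp-falls : ∀ o {a b a′ b′} → T (falls (applyOp o a b) (applyOp o a′ b′)) →
                T (falls a a′) ⊎ T (falls b b′)
applyOp-falls o {a} {b} {a′} {b′} fall with T? (falls a a′) | T? (falls b b′)
... | yes a-falls | _          = inj₁ a-falls
... | no _        | yes b-falls = inj₂ b-falls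
... | no a-rises  | no b-rises  =
  ⊥-elim (w̸ (applyOp-mono o (no-fall⇒rise a a′ a-rises) (no-fall⇒rise b b′ b-rises) u))
  where
  u : T (applyOp o a b)
  u = proj₁ (falls-elim fall)
  w̸ : ¬ T (applyOp o a′ b′)
  w̸ = proj₂ (falls-elim fall)

value : ∀ {I s} → Gates I s → (I → Bool) → Node I s → Bool
value G x v = nodeVal x (gateVals G x) v

value-mono : ∀ {I s} (G : Gates I s) {x x′ : I → Bool} → (∀ i → T (x i) → T (x′ i)) →
             ∀ v → T (value G x v) → T (value G x′ v)
value-mono G                 x≤x′ (inj₂ i)       = x≤x′ i
value-mono (G ▷ (o , a , b)) x≤x′ (inj₁ zero)     =
  applyOp-mono o (value-mono G x≤x′ a) (value-mono G x≤x′ b)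
value-mono (G ▷ _)           x≤x′ (inj₁ (suc g)) = value-mono G x≤x′ (inj₁ g)

reach : ∀ {I s} → Gates I s → Node I s → ℕ → List I
reach G                 (inj₂ i)        d       = i ∷ []
reach (G ▷ (o , a , b)) (inj₁ zero)     zero    = []
reach (G ▷ (o , a , b)) (inj₁ zero)     (suc d) = reach G a d ++ reach G b d
reach (G ▷ _)           (inj₁ (suc g))  d       = reach G (inj₁ g) d

-- Gates have fan-in two, so at most 2^d inputs are that close.
reach-length : ∀ {I s} (G : Gates I s) v d → length (reach G v d) ≤ 2 ^ d
reach-length G                 (inj₂ i)       d       = m^n>0 2 d
reach-length (G ▷ (o , a , b)) (inj₁ zero)    zero    = z≤n
reach-length (G ▷ (o , a , b)) (inj₁ zero)    (suc d) = begin
  length (reach G a d ++ reach G b d)          ≡⟨ length-++ (reach G a d) ⟩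
  length (reach G a d) + length (reach G b d)  ≤⟨ +-mono-≤ (reach-length G a d) (reach-length G b d) ⟩
  2 ^ d + 2 ^ d                                ≡⟨ cong (2 ^ d +_) (+-identityʳ (2 ^ d)) ⟨
  2 ^ suc d                                    ∎
  where open ≤-Reasoning
reach-length (G ▷ _)           (inj₁ (suc g)) d       = reach-length G (inj₁ g) d

reach-mono : ∀ {I s} (G : Gates I s) v {d d′ i} → d ≤ d′ → i ∈ reach G v d → i ∈ reach G v d′
reach-mono G                 (inj₂ _)       _         i∈ = i∈
reach-mono (G ▷ (o , a , b)) (inj₁ zero)    {suc d} {suc d′} (s≤s d≤d′) i∈
  with ∈-++⁻ (reach G a d) i∈
... | inj₁ i∈a = ∈-++⁺ˡ (reach-mono G a d≤d′ i∈a)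
... | inj₂ i∈b = ∈-++⁺ʳ (reach G a d′) (reach-mono G b d≤d′ i∈b)
reach-mono (G ▷ _)           (inj₁ (suc g)) d≤d′      i∈ = reach-mono G (inj₁ g) d≤d′ i∈

fallen : ∀ {I s} → Gates I s → (I → Bool) → (I → Bool) → ℕ
fallen []      x x′ = 0
fallen (G ▷ g) x x′ = χ (falls (value (G ▷ g) x (inj₁ zero)) (value (G ▷ g) x′ (inj₁ zero))) + fallen G x x′

-- A falling node is connected to a falling input by a path of falling
-- gates; in particular that input is reachable within `fallen` steps.
fall-trace : ∀ {I s} (G : Gates I s) (x x′ : I → Bool) v →
             T (falls (value G x v) (value G x′ v)) →
             ∃ λ i → T (falls (x i) (x′ i)) × i ∈ reach G v (fallen G x x′)
fall-trace G x x′ (inj₂ i) fall = i , fall , here refl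
fall-trace (G ▷ (o , a , b)) x x′ (inj₁ zero) fall
  rewrite χ-T fall with applyOp-falls o fall
... | inj₁ a-falls = let i , i-falls , i∈ = fall-trace G x x′ a a-falls in i , i-falls , ∈-++⁺ˡ i∈
... | inj₂ b-falls = let i , i-falls , i∈ = fall-trace G x x′ b b-falls in
                     i , i-falls , ∈-++⁺ʳ (reach G a (fallen G x x′)) i∈
fall-trace (G ▷ g) x x′ (inj₁ (suc h)) fall =
  let i , i-falls , i∈ = fall-trace G x x′ (inj₁ h) fall in
  i , i-falls , reach-mono G (inj₁ h) (m≤n+m _ _) i∈

-- Fix the selector part Y of the input.  Node v
-- carries the variable x_{a,j} if v is 1 when x_{a,j} is the only 1 among
-- the x's and 0 when x_{a,j} is the only 0, i.e. its value falls between
-- these two assignments.  A node computing x_{a,j} (given Y) carries it.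
module Carrying {n q m : ℕ} where

  Input : Set
  Input = PInput n q m

  _≟ₓ_ : DecidableEquality (Fin n × Fin q)
  _≟ₓ_ = Productₚ.≡-dec Finₚ._≟_ Finₚ._≟_

  _≟ᵢ_ : DecidableEquality Input
  _≟ᵢ_ = Sumₚ.≡-dec _≟ₓ_ Finₚ._≟_

  unit counit : Fin n → Fin q → Fin n → Fin q → Bool
  unit   a j b k = isYes ((a , j) ≟ₓ (b , k))
  counit a j b k = not (unit a j b k)

  carries : ∀ {s} → Gates Input s → Vec Bool m → Fin n → Fin q → Node Input s → Bool
  carries G Y a j v = falls (value G (assign (unit a j) Y) v) (value G (assign (counit a j) Y) v)

  carriers : ∀ {s} → Gates Input s → Vec Bool m → Fin n → Fin q → ℕ
  carriers G Y a j = fallen G (assign (unit a j) Y) (assign (counit a j) Y)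

  unit≤counit : ∀ (Y : Vec Bool m) {a j b k} → (a , j) ≢ (b , k) →
                ∀ (i : Input) → T (assign (unit b k) Y i) → T (assign (counit a j) Y i)
  unit≤counit Y ne (inj₂ y) yᵢ = yᵢ
  unit≤counit Y {a} {j} {b} {k} ne (inj₁ (c , l)) bk≡cl =
    fromWitnessFalse {a? = (a , j) ≟ₓ (c , l)}
      (λ aj≡cl → ne (trans aj≡cl (sym (toWitness {a? = (b , k) ≟ₓ (c , l)} bk≡cl))))

  -- By monotonicity a node carries at most one variable.
  carries-unique : ∀ {s} (G : Gates Input s) Y v {a j b k} →
                   T (carries G Y a j v) → T (carries G Y b k v) → a ≡ b × j ≡ k
  carries-unique G Y v {a} {j} {b} {k} carries-aj carries-bk with (a , j) ≟ₓ (b , k)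
  ... | yes refl = refl , refl
  ... | no ne    = ⊥-elim (counit-low (value-mono G (unit≤counit Y ne) v unit-high))
    where
    counit-low : ¬ T (value G (assign (counit a j) Y) v)
    counit-low = proj₂ (falls-elim {value G (assign (unit a j) Y) v} carries-aj)
    unit-high : T (value G (assign (unit b k) Y) v)
    unit-high = proj₁ (falls-elim {value G (assign (unit b k) Y) v} carries-bk)

  carrying-input : ∀ (Y : Vec Bool m) a j (i : Input) →
                   T (falls (assign (unit a j) Y i) (assign (counit a j) Y i)) → i ≡ inj₁ (a , j)
  carrying-input Y a j (inj₁ (b , k)) fall =
    cong inj₁ (sym (toWitness {a? = (a , j) ≟ₓ (b , k)} (proj₁ (falls-elim {unit a j b k} fall))))
  carrying-input Y a j (inj₂ y) fall = ⊥-elim (no-self-fall (lookup Y y) fall)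

  carrier-reach : ∀ {s} (G : Gates Input s) Y v {a j} → T (carries G Y a j v) →
                  inj₁ (a , j) ∈ reach G v (carriers G Y a j)
  carrier-reach G Y v {a} {j} carrying =
    let i , i-falls , i∈ = fall-trace G (assign (unit a j) Y) (assign (counit a j) Y) v carrying
    in subst (_∈ reach G v (carriers G Y a j)) (carrying-input Y a j i i-falls) i∈

  -- Each gate carries at most one variable, so there are at most s
  -- carrying gates in all.
  carriers-total : ∀ {s} (G : Gates Input s) Y → ∑[ a < n ] ∑[ j < q ] carriers G Y a j ≤ s
  carriers-total []      Y = ≤-reflexive (∑-zero {n} _ (λ a → ∑-zero {q} _ (λ j → refl)))
  carriers-total {suc s} (G ▷ g) Y = begin
    ∑[ a < n ] ∑[ j < q ] (χ (top a j) + carriers G Y a j)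
      ≡⟨ ∑₂-distrib-+ (λ a j → χ (top a j)) (carriers G Y) ⟩
    ∑[ a < n ] count (top a) + ∑[ a < n ] ∑[ j < q ] carriers G Y a j
      ≤⟨ +-mono-≤ (count₂-atMostOne top (carries-unique (G ▷ g) Y (inj₁ zero))) (carriers-total G Y) ⟩
    suc s ∎
    where
    open ≤-Reasoning
    top : Fin n → Fin q → Bool
    top a j = carries (G ▷ g) Y a j (inj₁ zero)

  carriers-total-permuted : ∀ {s} (G : Gates Input s) Y (π : Permutation′ n) →
                            ∑[ i < n ] ∑[ j < q ] carriers G Y (π ⟨$⟩ʳ i) j ≤ s
  carriers-total-permuted G Y π =
    ≤-trans (≤-reflexive (sym (sum-permute (λ a → ∑[ j < q ] carriers G Y a j) π))) (carriers-total G Y)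

  carrier-depths-sparse : ∀ {r s} (G : Gates Input s) v (Y : Fin r → Vec Bool m) (ρ : Fin r → Fin n) →
                          Injective _≡_ _≡_ ρ → (j : Fin q) → (∀ k → T (carries G (Y k) (ρ k) j v)) →
                          ∀ u → count (λ k → carriers G (Y k) (ρ k) j ≤ᵇ u) ≤ 2 ^ u
  carrier-depths-sparse {r} G v Y ρ ρ-injective j carrying u =
    ≤-trans (count-injection _≟ᵢ_ τ τ-injective _ (reach G v u) within-u) (reach-length G v u)
    where
    τ : Fin r → Input
    τ k = inj₁ (ρ k , j)
    τ-injective : Injective _≡_ _≡_ τ
    τ-injective τk≡τk′ = ρ-injective (Productₚ.,-injectiveˡ (Sumₚ.inj₁-injective τk≡τk′))
    within-u : ∀ k → T (carriers G (Y k) (ρ k) j ≤ᵇ u) → τ k ∈ reach G v u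
    within-u k depth≤u = reach-mono G v (≤ᵇ⇒≤ _ u depth≤u) (carrier-reach G (Y k) v (carrying k))

  output-carries : ∀ {s} (σ : Permutation′ n → Vec Bool m) (C : Circuit Input (POutput n q) s) →
                   ComputesP σ C → ∀ π i j →
                   T (carries (Circuit.gates C) (σ π) (π ⟨$⟩ʳ i) j (Circuit.output C (i , j)))
  output-carries σ C computes π i j = falls-intro {u} {w} u-true w-false
    where
    a : Fin n
    a = π ⟨$⟩ʳ i
    u w : Bool
    u = evalC C (assign (unit a j) (σ π)) (i , j)
    w = evalC C (assign (counit a j) (σ π)) (i , j)
    unit-diagonal : T (unit a j a j)
    unit-diagonal = fromWitness {a? = (a , j) ≟ₓ (a , j)} refl
    u-true : T u
    u-true = subst T (sym (computes π (unit a j) i j)) unit-diagonal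
    w-false : ¬ T w
    w-false w-true = T-not unit-diagonal (subst T (computes π (counit a j) i j) w-true)

lower-bound : ∀ {n q m s} .{{_ : NonZero n}} (σ : Permutation′ n → Vec Bool m)
              (C : Circuit (PInput n q m) (POutput n q) s) → ComputesP σ C →
              n ^ (q * n) ≤ 2 ^ (s + 2 * (q * n))
lower-bound {n} {q} {m} {s} σ C computes =
  power-bound n q s t n<2^[1+t]
    (*-cancelˡ-≤ n (subst (n * (q * (t * n)) ≤_) (sym (*-distribˡ-+ n s (q * n))) counted))
  where
  open Rotation n
  open Carrying {n} {q} {m}
  bracket : ∃ λ t → 2 ^ t ≤ n × n < 2 ^ suc t
  bracket = dyadic-interval n
  t : ℕ
  t = proj₁ bracket
  2^t≤n : 2 ^ t ≤ n
  2^t≤n = proj₁ (proj₂ bracket)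
  n<2^[1+t] : n < 2 ^ suc t
  n<2^[1+t] = proj₂ (proj₂ bracket)
  G : Gates (PInput n q m) s
  G = Circuit.gates C
  depth : Fin n → Fin q → Fin n → ℕ
  depth i j k = carriers G (σ (rotation k)) (rotation k ⟨$⟩ʳ i) j
  per-rotation : ∀ k → ∑[ i < n ] ∑[ j < q ] depth i j k ≤ s
  per-rotation k = carriers-total-permuted G (σ (rotation k)) (rotation k)
  per-output : ∀ i j → t * n ≤ ∑[ k < n ] depth i j k + n
  per-output i j = depth-sum-bound (depth i j) sparse t 2^t≤n
    where
    sparse : ∀ u → count (λ k → depth i j k ≤ᵇ u) ≤ 2 ^ u
    sparse = carrier-depths-sparse G (Circuit.output C (i , j)) (σ ∘ rotation)
               (λ k → rotation k ⟨$⟩ʳ i) (rotation-injective i) j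
               (λ k → output-carries σ C computes (rotation k) i j)
  counted : n * (q * (t * n)) ≤ n * s + n * (q * n)
  counted = double-counting depth s (t * n) n per-rotation per-output

mainTheorem4 : Σ ℕ λ c → 0 < c ×
    ((n q m : ℕ) → 2 ≤ n → 1 ≤ q → 1 ≤ m →
    (σ : Permutation′ n → Vec Bool m) → InjectivePerm σ → AntichainImage σ →
    (s : ℕ) (C : Circuit (PInput n q m) (POutput n q) s) → ComputesP σ C →
    n ^ (q * n) ≤ 2 ^ (s + c * (q * n)))
mainTheorem4 = 2 , s≤s z≤n , λ n q m 2≤n _ _ σ _ _ s C computes →
  lower-bound {{>-nonZero (≤-trans (s≤s z≤n) 2≤n)}} σ C computes
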